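{- For every composition $I=(i_1,\dots,i_k)$ of $n$ of length $k$, $$\sum_{J\vDash n,\ \ell(J)=k}\ \prod_{s=1}^k\binom{j_1+\cdots+j_s-(i_1+\cdots+i_{s-1})-1}{i_s-1}=\prod_{s=2}^k\binom{i_1+\cdots+i_s-1}{i_1+\cdots+i_{s-1}},$$ the sum being over all compositions $J=(j_1,\dots,j_k)$ of $n$ of length $k$.
   Context: Compositions of $n$ are finite sequences of positive integers summing to $n$; $\ell(J)$ is the number of parts. Binomial coefficients $\binom{m}{r}$ are zero when $m<r$ (for integers $m\ge 0$, $r\ge 0$). -}

module Defs where

open import Data.Nat using (ℕ; zero; suc; _+_; _*_; _∸_; _≤_)
open import Data.Nat.Combinatorics using (_C_)
open import Data.Integer as ℤ using (ℤ; +_; -[1+_])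
open import Data.List using (List; []; _∷_; length; map; concatMap; upTo; take; applyUpTo)
open import Data.Nat.ListAction using (sum; product)
open import Data.List.Relation.Unary.All using (All)

IsComposition : ℕ → List ℕ → Set
IsComposition n J = All (λ j → 1 ≤ j) J × (sum J ≡ n)
  where
  open import Data.Product using (_×_)
  open import Relation.Binary.PropositionalEquality using (_≡_)

compositions : ℕ → ℕ → List (List ℕ)
compositions zero    zero    = [] ∷ []
compositions (suc n) zero    = []
compositions n       (suc k) =
  concatMap (λ a → map (suc a ∷_) (compositions (n ∸ suc a) k)) (upTo n)

-- Binomial coefficient with integer top entry: zero when the top is negative,
-- and (as in Data.Nat.Combinatorics) zero when m < r.
choose : ℤ → ℕ → ℕ
choose (+ m)    r = m C r
choose -[1+ _ ] r = 0

psum : ℕ → List ℕ → ℕ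
psum s xs = sum (take s xs)

-- i-th entry (1-based), 0 if out of range
entry : ℕ → List ℕ → ℕ
entry _             []       = 0
entry zero          (x ∷ xs) = 0
entry (suc zero)    (x ∷ xs) = x
entry (suc (suc s)) (x ∷ xs) = entry (suc s) xs

lhsTerm : ℕ → List ℕ → List ℕ → ℕ
lhsTerm k I J = product (applyUpTo (λ t → let s = suc t in
  choose ((+ psum s J) ℤ.- (+ psum t I) ℤ.- + 1) (entry s I ∸ 1)) k)

rhs : ℕ → List ℕ → ℕ
rhs k I = product (applyUpTo (λ t → let s = suc (suc t) in
  choose ((+ psum s I) ℤ.- + 1) (psum (suc t) I)) (k ∸ 1))

-- Write a_t = i₁ + ⋯ + i_t and b_s = j₁ + ⋯ + j_s. The summand is ∏_t F_t(b_{t+1}) with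
-- F_t(b) = C(b − a_t − 1, i_{t+1} − 1), so the left side is a weighted count of chains
-- 0 < b₁ < ⋯ < b_k = n. Summing out b₁, b₂, … in turn, the total weight W_s(c) of the
-- chains of length s ending at c satisfies
--   ∑_{c ≤ b} W_s(c) = C(b, a_s) · ∏_{t<s} C(a_{t+1} − 1, a_t).
-- In the inductive step, trinomial revision
--   C(d − a_t, i_{t+1} − 1) · C(d, a_t) = C(d, a_{t+1} − 1) · C(a_{t+1} − 1, a_t)
-- turns the weight into C(d, a_{t+1} − 1), which the hockey-stick identity sums over d < b.
-- At the endpoint b_k = n = a_k the last weight collapses to C(n − 1, n − 1) = 1, and the
-- factor t = 0 of the product is C(i₁ − 1, 0) = 1, leaving the right-hand side.

module Submission where

open import Defs
import Algebra.Properties.CommutativeSemigroup as CommutativeSemigroupProperties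
open import Data.Integer as ℤ using (_⊖_)
open import Data.Integer.Properties using (m-n≡m⊖n; ⊖-≥)
open import Data.List using (List; []; _∷_; [_]; _++_; length; map; concatMap; upTo; applyUpTo)
open import Data.List.Properties using (applyUpTo-∷ʳ; map-upTo; map-∘; map-cong; map-concatMap; take-all)
open import Data.List.Relation.Unary.All using (All; []; _∷_)
open import Data.Nat using (ℕ; zero; suc; _+_; _*_; _∸_; _≤_; _<_; _!; _≤?_; z≤n; s≤s)
open import Data.Nat.Combinatorics using (_C_; nCk≡n!/k![n-k]!; k![n∸k]!∣n!; k>n⇒nCk≡0; nCn≡1; nCk+nC[k+1]≡[n+1]C[k+1])
open import Data.Nat.DivMod using (_/_; m/n*n≡m)
open import Data.Nat.ListAction using (sum; product)
open import Data.Nat.ListAction.Properties using (sum-++; product-++)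
open import Data.Nat.Properties
open import Data.Nat.Tactic.RingSolver using (solve-∀)
open import Data.Product using (_,_)
open import Function using (_∘_)
open import Relation.Binary.PropositionalEquality using (_≡_; refl; sym; trans; cong; cong₂; subst; module ≡-Reasoning)
open import Relation.Nullary using (yes; no)

open ≡-Reasoning
open CommutativeSemigroupProperties +-commutativeSemigroup using (interchange)
open CommutativeSemigroupProperties *-commutativeSemigroup using (x∙yz≈y∙xz)

∑< : ℕ → (ℕ → ℕ) → ℕ
∑< m h = sum (applyUpTo h m)

-- Binds looser than _*_ and _C_ but tighter than _+_: ∑[ a < m ] f a + x is (∑ f) + x.
infixr 6.4 ∑<
syntax ∑< m (λ a → e) = ∑[ a < m ] e

applyUpTo-cong : ∀ {A : Set} {f g : ℕ → A} m → (∀ a → a < m → f a ≡ g a) → applyUpTo f m ≡ applyUpTo g m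
applyUpTo-cong zero    f≡g = refl
applyUpTo-cong (suc m) f≡g = cong₂ _∷_ (f≡g 0 (s≤s z≤n)) (applyUpTo-cong m (λ a a<m → f≡g (suc a) (s≤s a<m)))

∑-cong : ∀ m {h h' : ℕ → ℕ} → (∀ a → a < m → h a ≡ h' a) → ∑[ a < m ] h a ≡ ∑[ a < m ] h' a
∑-cong m h≡h' = cong sum (applyUpTo-cong m h≡h')

∑-snoc : ∀ m (h : ℕ → ℕ) → ∑[ a < suc m ] h a ≡ ∑[ a < m ] h a + h m
∑-snoc m h = begin
  ∑[ a < suc m ] h a                   ≡⟨ cong sum (applyUpTo-∷ʳ h m) ⟨
  sum (applyUpTo h m ++ [ h m ])       ≡⟨ sum-++ (applyUpTo h m) [ h m ] ⟩
  ∑[ a < m ] h a + (h m + 0)           ≡⟨ cong (∑< m h +_) (+-identityʳ (h m)) ⟩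
  ∑[ a < m ] h a + h m                 ∎

∑-zero : ∀ m → ∑[ a < m ] 0 ≡ 0
∑-zero zero    = refl
∑-zero (suc m) = ∑-zero m

∑-+ : ∀ m (h h' : ℕ → ℕ) → ∑[ a < m ] (h a + h' a) ≡ ∑[ a < m ] h a + ∑[ a < m ] h' a
∑-+ zero    h h' = refl
∑-+ (suc m) h h' = begin
  h 0 + h' 0 + ∑[ a < m ] (h (suc a) + h' (suc a))
    ≡⟨ cong (h 0 + h' 0 +_) (∑-+ m (h ∘ suc) (h' ∘ suc)) ⟩
  h 0 + h' 0 + (∑[ a < m ] h (suc a) + ∑[ a < m ] h' (suc a))
    ≡⟨ interchange (h 0) (h' 0) _ _ ⟩
  h 0 + ∑[ a < m ] h (suc a) + (h' 0 + ∑[ a < m ] h' (suc a)) ∎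

∑-*ˡ : ∀ m c (h : ℕ → ℕ) → ∑[ a < m ] c * h a ≡ c * (∑[ a < m ] h a)
∑-*ˡ zero    c h = sym (*-zeroʳ c)
∑-*ˡ (suc m) c h = begin
  c * h 0 + ∑[ a < m ] c * h (suc a)   ≡⟨ cong (c * h 0 +_) (∑-*ˡ m c (h ∘ suc)) ⟩
  c * h 0 + c * (∑[ a < m ] h (suc a)) ≡⟨ *-distribˡ-+ c (h 0) _ ⟨
  c * (h 0 + ∑[ a < m ] h (suc a))     ∎

∑-*ʳ : ∀ m c (h : ℕ → ℕ) → ∑[ a < m ] h a * c ≡ (∑[ a < m ] h a) * c
∑-*ʳ m c h = trans (∑-cong m (λ a _ → *-comm (h a) c)) (trans (∑-*ˡ m c h) (*-comm c _))

∑-interchange : ∀ m (g : ℕ → ℕ → ℕ) →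
  ∑[ c < m ] ∑[ a < c ] g a (c ∸ suc a) ≡ ∑[ a < m ] ∑[ c < m ∸ suc a ] g a c
∑-interchange zero    g = refl
∑-interchange (suc m) g = begin
  ∑[ c < suc m ] ∑[ a < c ] g a (c ∸ suc a)
    ≡⟨ ∑-snoc m _ ⟩
  ∑[ c < m ] ∑[ a < c ] g a (c ∸ suc a) + ∑[ a < m ] g a (m ∸ suc a)
    ≡⟨ cong (_+ ∑[ a < m ] g a (m ∸ suc a)) (∑-interchange m g) ⟩
  ∑[ a < m ] ∑[ c < m ∸ suc a ] g a c + ∑[ a < m ] g a (m ∸ suc a)
    ≡⟨ ∑-+ m _ _ ⟨
  ∑[ a < m ] (∑[ c < m ∸ suc a ] g a c + g a (m ∸ suc a))
    ≡⟨ ∑-cong m (λ a a<m → trans (sym (∑-snoc (m ∸ suc a) (g a))) (cong (λ l → ∑[ c < l ] g a c) (sym (+-∸-assoc 1 a<m)))) ⟩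
  ∑[ a < m ] ∑[ c < m ∸ a ] g a c
    ≡⟨ +-identityʳ _ ⟨
  ∑[ a < m ] ∑[ c < m ∸ a ] g a c + ∑[ c < 0 ] g m c
    ≡⟨ cong (λ l → ∑[ a < m ] ∑[ c < m ∸ a ] g a c + ∑[ c < l ] g m c) (n∸n≡0 m) ⟨
  ∑[ a < m ] ∑[ c < m ∸ a ] g a c + ∑[ c < m ∸ m ] g m c
    ≡⟨ ∑-snoc m (λ a → ∑[ c < m ∸ a ] g a c) ⟨
  ∑[ a < suc m ] ∑[ c < suc m ∸ suc a ] g a c ∎

hockey-stick : ∀ b k → ∑[ d < b ] d C k ≡ b C suc k
hockey-stick zero    k = refl
hockey-stick (suc b) k = begin
  ∑[ d < suc b ] d C k     ≡⟨ ∑-snoc b (_C k) ⟩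
  ∑[ d < b ] d C k + b C k ≡⟨ cong (_+ b C k) (hockey-stick b k) ⟩
  b C suc k + b C k        ≡⟨ +-comm (b C suc k) (b C k) ⟩
  b C k + b C suc k        ≡⟨ nCk+nC[k+1]≡[n+1]C[k+1] b k ⟩
  suc b C suc k            ∎

product-applyUpTo-snoc : ∀ q s → product (applyUpTo q (suc s)) ≡ product (applyUpTo q s) * q s
product-applyUpTo-snoc q s = begin
  product (applyUpTo q (suc s))              ≡⟨ cong product (applyUpTo-∷ʳ q s) ⟨
  product (applyUpTo q s ++ [ q s ])         ≡⟨ product-++ (applyUpTo q s) [ q s ] ⟩
  product (applyUpTo q s) * (q s * 1)        ≡⟨ cong (product (applyUpTo q s) *_) (*-identityʳ (q s)) ⟩
  product (applyUpTo q s) * q s              ∎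

nCk*[k!*[n∸k]!]≡n! : ∀ {n k} → k ≤ n → (n C k) * (k ! * (n ∸ k) !) ≡ n !
nCk*[k!*[n∸k]!]≡n! {n} {k} k≤n = begin
  (n C k) * (k ! * (n ∸ k) !)                  ≡⟨ cong (_* (k ! * (n ∸ k) !)) (nCk≡n!/k![n-k]! k≤n) ⟩
  (n ! / (k ! * (n ∸ k) !)) * (k ! * (n ∸ k) !) ≡⟨ m/n*n≡m (k![n∸k]!∣n! k≤n) ⟩
  n !                                           ∎
  where instance _ = k !* (n ∸ k) !≢0

[n∸k]Cr*nCk≡nC[k+r]*[k+r]Ck : ∀ n k r → ((n ∸ k) C r) * (n C k) ≡ (n C (k + r)) * ((k + r) C k)
[n∸k]Cr*nCk≡nC[k+r]*[k+r]Ck n k r with k + r ≤? n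
... | yes k+r≤n = *-cancelʳ-≡ _ _ (k ! * (r ! * e !)) (trans lhs≡n! (sym rhs≡n!))
  where
  e = n ∸ (k + r)
  instance
    k!*[r!*e!]≢0 = m*n≢0 (k !) (r ! * e !) {{k !≢0}} {{m*n≢0 (r !) (e !) {{r !≢0}} {{e !≢0}}}}
  lhs≡n! : ((n ∸ k) C r) * (n C k) * (k ! * (r ! * e !)) ≡ n !
  lhs≡n! = begin
    ((n ∸ k) C r) * (n C k) * (k ! * (r ! * e !))
      ≡⟨ shape ((n ∸ k) C r) (n C k) (k !) (r !) (e !) ⟩
    (n C k) * (k ! * (((n ∸ k) C r) * (r ! * e !)))
      ≡⟨ cong (λ x → (n C k) * (k ! * (((n ∸ k) C r) * (r ! * x !)))) (∸-+-assoc n k r) ⟨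
    (n C k) * (k ! * (((n ∸ k) C r) * (r ! * (n ∸ k ∸ r) !)))
      ≡⟨ cong (λ x → (n C k) * (k ! * x)) (nCk*[k!*[n∸k]!]≡n! (m+n≤o⇒m≤o∸n r (subst (_≤ n) (+-comm k r) k+r≤n))) ⟩
    (n C k) * (k ! * (n ∸ k) !)
      ≡⟨ nCk*[k!*[n∸k]!]≡n! (≤-trans (m≤m+n k r) k+r≤n) ⟩
    n ! ∎
    where
    shape : ∀ x y a b c → x * y * (a * (b * c)) ≡ y * (a * (x * (b * c)))
    shape = solve-∀
  rhs≡n! : (n C (k + r)) * ((k + r) C k) * (k ! * (r ! * e !)) ≡ n !
  rhs≡n! = begin
    (n C (k + r)) * ((k + r) C k) * (k ! * (r ! * e !))
      ≡⟨ shape (n C (k + r)) ((k + r) C k) (k !) (r !) (e !) ⟩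
    (n C (k + r)) * (((k + r) C k) * (k ! * r !) * e !)
      ≡⟨ cong (λ x → (n C (k + r)) * (((k + r) C k) * (k ! * x !) * e !)) (m+n∸m≡n k r) ⟨
    (n C (k + r)) * (((k + r) C k) * (k ! * (k + r ∸ k) !) * e !)
      ≡⟨ cong (λ x → (n C (k + r)) * (x * e !)) (nCk*[k!*[n∸k]!]≡n! (m≤m+n k r)) ⟩
    (n C (k + r)) * ((k + r) ! * e !)
      ≡⟨ nCk*[k!*[n∸k]!]≡n! k+r≤n ⟩
    n ! ∎
    where
    shape : ∀ x y a b c → x * y * (a * (b * c)) ≡ x * (y * (a * b) * c)
    shape = solve-∀
... | no k+r≰n = trans lhs≡0 (sym (cong (_* ((k + r) C k)) (k>n⇒nCk≡0 (≰⇒> k+r≰n))))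
  where
  lhs≡0 : ((n ∸ k) C r) * (n C k) ≡ 0
  lhs≡0 with k ≤? n
  ... | yes k≤n = cong (_* (n C k)) (k>n⇒nCk≡0 (≰⇒> (λ r≤n∸k → k+r≰n (subst (_≤ n) (+-comm r k) (m≤o∸n⇒m+n≤o r k≤n r≤n∸k)))))
  ... | no k≰n = trans (cong (((n ∸ k) C r) *_) (k>n⇒nCk≡0 (≰⇒> k≰n))) (*-zeroʳ ((n ∸ k) C r))

compositionWeight : ℕ → (ℕ → ℕ → ℕ) → ℕ → List ℕ → ℕ
compositionWeight k F base J = product (applyUpTo (λ t → F t (base + psum (suc t) J)) k)

-- base is the sum of the parts already split off, so F always sees absolute partial sums.
totalWeight : ℕ → (ℕ → ℕ → ℕ) → ℕ → ℕ → ℕ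
totalWeight zero    F base zero    = 1
totalWeight zero    F base (suc m) = 0
totalWeight (suc k) F base m =
  ∑[ a < m ] F 0 (base + suc a) * totalWeight k (F ∘ suc) (base + suc a) (m ∸ suc a)

compositionWeight-∷ : ∀ k F base x J →
  compositionWeight (suc k) F base (x ∷ J) ≡ F 0 (base + x) * compositionWeight k (F ∘ suc) (base + x) J
compositionWeight-∷ k F base x J =
  cong₂ _*_ (cong (λ y → F 0 (base + y)) (+-identityʳ x))
            (cong product (applyUpTo-cong k (λ t _ → cong (F (suc t)) (sym (+-assoc base x (psum (suc t) J))))))

sum-map-*ˡ : ∀ {A : Set} c (f : A → ℕ) xs → sum (map (λ x → c * f x) xs) ≡ c * sum (map f xs)
sum-map-*ˡ c f []       = sym (*-zeroʳ c)
sum-map-*ˡ c f (x ∷ xs) = trans (cong (c * f x +_) (sum-map-*ˡ c f xs)) (sym (*-distribˡ-+ c (f x) _))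

sum-concatMap : ∀ {A : Set} (f : A → List ℕ) xs → sum (concatMap f xs) ≡ sum (map (sum ∘ f) xs)
sum-concatMap f []       = refl
sum-concatMap f (x ∷ xs) = trans (sum-++ (f x) (concatMap f xs)) (cong (sum (f x) +_) (sum-concatMap f xs))

compositions-suc : ∀ m k →
  compositions m (suc k) ≡ concatMap (λ a → map (suc a ∷_) (compositions (m ∸ suc a) k)) (upTo m)
compositions-suc zero    k = refl
compositions-suc (suc m) k = refl

sum-compositionWeight : ∀ k F base m →
  sum (map (compositionWeight k F base) (compositions m k)) ≡ totalWeight k F base m
sum-compositionWeight zero    F base zero    = refl
sum-compositionWeight zero    F base (suc m) = refl
sum-compositionWeight (suc k) F base m = begin
  sum (map w (compositions m (suc k)))
    ≡⟨ cong (sum ∘ map w) (compositions-suc m k) ⟩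
  sum (map w (concatMap (λ a → map (suc a ∷_) (rest a)) (upTo m)))
    ≡⟨ cong sum (map-concatMap w _ (upTo m)) ⟩
  sum (concatMap (λ a → map w (map (suc a ∷_) (rest a))) (upTo m))
    ≡⟨ sum-concatMap _ (upTo m) ⟩
  sum (map (λ a → sum (map w (map (suc a ∷_) (rest a)))) (upTo m))
    ≡⟨ cong sum (map-upTo _ m) ⟩
  ∑[ a < m ] sum (map w (map (suc a ∷_) (rest a)))
    ≡⟨ ∑-cong m (λ a _ → firstPart a) ⟩
  totalWeight (suc k) F base m ∎
  where
  w = compositionWeight (suc k) F base
  rest : ℕ → List (List ℕ)
  rest a = compositions (m ∸ suc a) k
  firstPart : ∀ a → sum (map w (map (suc a ∷_) (rest a)))
                  ≡ F 0 (base + suc a) * totalWeight k (F ∘ suc) (base + suc a) (m ∸ suc a)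
  firstPart a = begin
    sum (map w (map (suc a ∷_) (rest a)))
      ≡⟨ cong sum (map-∘ (rest a)) ⟨
    sum (map (w ∘ (suc a ∷_)) (rest a))
      ≡⟨ cong sum (map-cong (compositionWeight-∷ k F base (suc a)) (rest a)) ⟩
    sum (map (λ J → c * w′ J) (rest a))
      ≡⟨ sum-map-*ˡ c w′ (rest a) ⟩
    c * sum (map w′ (rest a))
      ≡⟨ cong (c *_) (sum-compositionWeight k (F ∘ suc) (base + suc a) (m ∸ suc a)) ⟩
    c * totalWeight k (F ∘ suc) (base + suc a) (m ∸ suc a) ∎
    where
    c = F 0 (base + suc a)
    w′ = compositionWeight k (F ∘ suc) (base + suc a)

∑-totalWeight-zero : ∀ m F base → ∑[ c < suc m ] totalWeight 0 F base c ≡ 1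
∑-totalWeight-zero m F base = cong suc (∑-zero m)

totalWeight-last : ∀ k F base m →
  totalWeight (suc k) F base m ≡ F k (base + m) * (∑[ c < m ] totalWeight k F base c)
totalWeight-last zero F base zero = sym (*-zeroʳ (F 0 (base + 0)))
totalWeight-last zero F base (suc m) = begin
  ∑[ a < suc m ] F 0 (base + suc a) * totalWeight 0 (F ∘ suc) (base + suc a) (m ∸ a)
    ≡⟨ ∑-snoc m _ ⟩
  ∑[ a < m ] F 0 (base + suc a) * totalWeight 0 (F ∘ suc) (base + suc a) (m ∸ a)
    + F 0 (base + suc m) * totalWeight 0 (F ∘ suc) (base + suc m) (m ∸ m)
    ≡⟨ cong₂ _+_ (trans (∑-cong m earlier≡0) (∑-zero m))
                 (cong (λ x → F 0 (base + suc m) * totalWeight 0 (F ∘ suc) (base + suc m) x) (n∸n≡0 m)) ⟩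
  F 0 (base + suc m) * 1
    ≡⟨ cong (F 0 (base + suc m) *_) (∑-totalWeight-zero m F base) ⟨
  F 0 (base + suc m) * (∑[ c < suc m ] totalWeight 0 F base c) ∎
  where
  earlier≡0 : ∀ a → a < m → F 0 (base + suc a) * totalWeight 0 (F ∘ suc) (base + suc a) (m ∸ a) ≡ 0
  earlier≡0 a a<m = trans (cong (λ x → F 0 (base + suc a) * totalWeight 0 (F ∘ suc) (base + suc a) x) (+-∸-assoc 1 a<m))
                          (*-zeroʳ (F 0 (base + suc a)))
totalWeight-last (suc k) F base m = begin
  ∑[ a < m ] F 0 (b a) * totalWeight (suc k) (F ∘ suc) (b a) (m ∸ suc a)
    ≡⟨ ∑-cong m (λ a a<m → splitLast a a<m) ⟩
  ∑[ a < m ] F (suc k) (base + m) * (∑[ c < m ∸ suc a ] g a c)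
    ≡⟨ ∑-*ˡ m (F (suc k) (base + m)) _ ⟩
  F (suc k) (base + m) * (∑[ a < m ] ∑[ c < m ∸ suc a ] g a c)
    ≡⟨ cong (F (suc k) (base + m) *_) (∑-interchange m g) ⟨
  F (suc k) (base + m) * (∑[ c < m ] totalWeight (suc k) F base c) ∎
  where
  b : ℕ → ℕ
  b a = base + suc a
  g : ℕ → ℕ → ℕ
  g a c = F 0 (b a) * totalWeight k (F ∘ suc) (b a) c
  splitLast : ∀ a → a < m → F 0 (b a) * totalWeight (suc k) (F ∘ suc) (b a) (m ∸ suc a)
                          ≡ F (suc k) (base + m) * (∑[ c < m ∸ suc a ] g a c)
  splitLast a a<m = begin
    F 0 (b a) * totalWeight (suc k) (F ∘ suc) (b a) (m ∸ suc a)
      ≡⟨ cong (F 0 (b a) *_) (totalWeight-last k (F ∘ suc) (b a) (m ∸ suc a)) ⟩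
    F 0 (b a) * (F (suc k) (b a + (m ∸ suc a)) * rest)
      ≡⟨ cong (λ x → F 0 (b a) * (F (suc k) x * rest)) b[a]+[m∸1+a]≡base+m ⟩
    F 0 (b a) * (F (suc k) (base + m) * rest)
      ≡⟨ x∙yz≈y∙xz (F 0 (b a)) (F (suc k) (base + m)) rest ⟩
    F (suc k) (base + m) * (F 0 (b a) * rest)
      ≡⟨ cong (F (suc k) (base + m) *_) (∑-*ˡ (m ∸ suc a) (F 0 (b a)) _) ⟨
    F (suc k) (base + m) * (∑[ c < m ∸ suc a ] g a c) ∎
    where
    rest = ∑[ c < m ∸ suc a ] totalWeight k (F ∘ suc) (b a) c
    b[a]+[m∸1+a]≡base+m : b a + (m ∸ suc a) ≡ base + m
    b[a]+[m∸1+a]≡base+m = trans (+-assoc base (suc a) _) (cong (base +_) (m+[n∸m]≡n a<m))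

record Transfer (F : ℕ → ℕ → ℕ) (a p q : ℕ → ℕ) (t : ℕ) : Set where
  field
    a-suc    : a (suc t) ≡ suc (p t)
    transfer : ∀ d → F t (suc d) * (d C a t) ≡ (d C p t) * q t

transfer-* : ∀ {F a p q t} → Transfer F a p q t →
  ∀ d Q → F t (suc d) * ((d C a t) * Q) ≡ (d C p t) * (Q * q t)
transfer-* {F} {a} {p} {q} {t} T d Q = begin
  F t (suc d) * ((d C a t) * Q) ≡⟨ *-assoc (F t (suc d)) _ Q ⟨
  F t (suc d) * (d C a t) * Q   ≡⟨ cong (_* Q) (Transfer.transfer T d) ⟩
  (d C p t) * q t * Q           ≡⟨ *-assoc (d C p t) (q t) Q ⟩
  (d C p t) * (q t * Q)         ≡⟨ cong ((d C p t) *_) (*-comm (q t) Q) ⟩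
  (d C p t) * (Q * q t)         ∎

∑-totalWeight : ∀ {F a p q} s → a 0 ≡ 0 → (∀ t → t < s → Transfer F a p q t) →
  ∀ b → ∑[ c < suc b ] totalWeight s F 0 c ≡ (b C a s) * product (applyUpTo q s)
∑-totalWeight {F} zero a₀ _ b rewrite a₀ = ∑-totalWeight-zero b F 0
∑-totalWeight {F} {a} {p} {q} (suc s) a₀ T b = begin
  ∑[ d < b ] totalWeight (suc s) F 0 (suc d)
    ≡⟨ ∑-cong b (λ d _ → totalWeight-last s F 0 (suc d)) ⟩
  ∑[ d < b ] F s (suc d) * (∑[ c < suc d ] totalWeight s F 0 c)
    ≡⟨ ∑-cong b (λ d _ → cong (F s (suc d) *_) (∑-totalWeight s a₀ (λ t t<s → T t (m<n⇒m<1+n t<s)) d)) ⟩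
  ∑[ d < b ] F s (suc d) * ((d C a s) * Q)
    ≡⟨ ∑-cong b (λ d _ → transfer-* Tₛ d Q) ⟩
  ∑[ d < b ] (d C p s) * (Q * q s)
    ≡⟨ ∑-*ʳ b (Q * q s) (_C p s) ⟩
  (∑[ d < b ] d C p s) * (Q * q s)
    ≡⟨ cong (_* (Q * q s)) (hockey-stick b (p s)) ⟩
  (b C suc (p s)) * (Q * q s)
    ≡⟨ cong₂ (λ x y → (b C x) * y) (Transfer.a-suc Tₛ) (product-applyUpTo-snoc q s) ⟨
  (b C a (suc s)) * product (applyUpTo q (suc s)) ∎
  where
  Q = product (applyUpTo q s)
  Tₛ = T s (n<1+n s)

totalWeight-endpoint : ∀ {F a p q} k → a 0 ≡ 0 → (∀ t → t < k → Transfer F a p q t) →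
  totalWeight k F 0 (a k) ≡ product (applyUpTo q k)
totalWeight-endpoint zero a₀ _ rewrite a₀ = refl
totalWeight-endpoint {F} {a} {p} {q} (suc s) a₀ T = begin
  totalWeight (suc s) F 0 (a (suc s))
    ≡⟨ cong (totalWeight (suc s) F 0) (Transfer.a-suc Tₛ) ⟩
  totalWeight (suc s) F 0 (suc (p s))
    ≡⟨ totalWeight-last s F 0 (suc (p s)) ⟩
  F s (suc (p s)) * (∑[ c < suc (p s) ] totalWeight s F 0 c)
    ≡⟨ cong (F s (suc (p s)) *_) (∑-totalWeight s a₀ (λ t t<s → T t (m<n⇒m<1+n t<s)) (p s)) ⟩
  F s (suc (p s)) * ((p s C a s) * Q)
    ≡⟨ transfer-* Tₛ (p s) Q ⟩
  (p s C p s) * (Q * q s)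
    ≡⟨ cong (_* (Q * q s)) (nCn≡1 (p s)) ⟩
  1 * (Q * q s)
    ≡⟨ *-identityˡ (Q * q s) ⟩
  Q * q s
    ≡⟨ product-applyUpTo-snoc q s ⟨
  product (applyUpTo q (suc s)) ∎
  where
  Q = product (applyUpTo q s)
  Tₛ = T s (n<1+n s)

choose-[1+d]-k-1 : ∀ {d k} r → k ≤ d → choose (ℤ.+ suc d ℤ.- ℤ.+ k ℤ.- ℤ.+ 1) r ≡ (d ∸ k) C r
choose-[1+d]-k-1 {d} {k} r k≤d = cong (λ z → choose (z ℤ.- ℤ.+ 1) r) (begin
  ℤ.+ suc d ℤ.- ℤ.+ k ≡⟨ m-n≡m⊖n (suc d) k ⟩
  suc d ⊖ k           ≡⟨ ⊖-≥ (m≤n⇒m≤1+n k≤d) ⟩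
  ℤ.+ (suc d ∸ k)     ≡⟨ cong ℤ.+_ (+-∸-assoc 1 k≤d) ⟩
  ℤ.+ suc (d ∸ k)     ∎)

choose[1+d-k-1]r*dCk≡dC[k+r]*[k+r]Ck : ∀ d k r →
  choose (ℤ.+ suc d ℤ.- ℤ.+ k ℤ.- ℤ.+ 1) r * (d C k) ≡ (d C (k + r)) * ((k + r) C k)
choose[1+d-k-1]r*dCk≡dC[k+r]*[k+r]Ck d k r with k ≤? d
... | yes k≤d = trans (cong (_* (d C k)) (choose-[1+d]-k-1 r k≤d)) ([n∸k]Cr*nCk≡nC[k+r]*[k+r]Ck d k r)
... | no k≰d = begin
  x * (d C k)                   ≡⟨ cong (x *_) (k>n⇒nCk≡0 (≰⇒> k≰d)) ⟩
  x * 0                         ≡⟨ *-zeroʳ x ⟩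
  0                             ≡⟨ cong (_* ((k + r) C k)) (k>n⇒nCk≡0 (≤-trans (≰⇒> k≰d) (m≤m+n k r))) ⟨
  (d C (k + r)) * ((k + r) C k) ∎
  where x = choose (ℤ.+ suc d ℤ.- ℤ.+ k ℤ.- ℤ.+ 1) r

-- lhsTerm k I is definitionally compositionWeight k (lhsFactor I) 0.
lhsFactor : List ℕ → ℕ → ℕ → ℕ
lhsFactor I t b = choose (ℤ.+ b ℤ.- ℤ.+ psum t I ℤ.- ℤ.+ 1) (entry (suc t) I ∸ 1)

rhsFactor : List ℕ → ℕ → ℕ
rhsFactor I t = (psum (suc t) I ∸ 1) C psum t I

psum-suc : ∀ t I → psum (suc t) I ≡ psum t I + entry (suc t) I
psum-suc zero    []      = refl
psum-suc (suc t) []      = refl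
psum-suc zero    (x ∷ I) = +-comm x 0
psum-suc (suc t) (x ∷ I) = trans (cong (x +_) (psum-suc t I)) (sym (+-assoc x _ _))

psum-length : ∀ I → psum (length I) I ≡ sum I
psum-length I = cong sum (take-all (length I) I ≤-refl)

entry-positive : ∀ {I t} → All (λ j → 1 ≤ j) I → t < length I → 1 ≤ entry (suc t) I
entry-positive {t = zero}  (1≤x ∷ _)        _         = 1≤x
entry-positive {t = suc t} (_ ∷ positive) (s≤s t<ℓ) = entry-positive positive t<ℓ

transfer-composition : ∀ {I} → All (λ j → 1 ≤ j) I → ∀ t → t < length I →
  Transfer (lhsFactor I) (λ s → psum s I) (λ s → psum (suc s) I ∸ 1) (rhsFactor I) t
transfer-composition {I} positive t t<ℓ = record
  { a-suc    = begin
      psum (suc t) I         ≡⟨ psum-suc t I ⟩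
      a + e                  ≡⟨ cong (a +_) (m+[n∸m]≡n 1≤e) ⟨
      a + suc (e ∸ 1)        ≡⟨ +-suc a (e ∸ 1) ⟩
      suc (a + (e ∸ 1))      ≡⟨ cong suc p≡a+[e∸1] ⟨
      suc (psum (suc t) I ∸ 1) ∎
  ; transfer = λ d → trans (choose[1+d-k-1]r*dCk≡dC[k+r]*[k+r]Ck d a (e ∸ 1))
                           (cong (λ x → (d C x) * (x C a)) (sym p≡a+[e∸1]))
  }
  where
  a = psum t I
  e = entry (suc t) I
  1≤e = entry-positive positive t<ℓ
  p≡a+[e∸1] : psum (suc t) I ∸ 1 ≡ a + (e ∸ 1)
  p≡a+[e∸1] = trans (cong (_∸ 1) (psum-suc t I)) (+-∸-assoc a 1≤e)

-- Since i₁ ≥ 1 every top entry of rhs is a positive integer, so past the factor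
-- rhsFactor I 0 = 1 the two products agree definitionally.
∏rhsFactor≡rhs : ∀ I → All (λ j → 1 ≤ j) I → product (applyUpTo (rhsFactor I) (length I)) ≡ rhs (length I) I
∏rhsFactor≡rhs []          []              = refl
∏rhsFactor≡rhs (suc i ∷ I) (s≤s z≤n ∷ _) = *-identityˡ _

mainTheorem8 : (n k : ℕ) (I : List ℕ) → IsComposition n I → length I ≡ k →
    sum (map (lhsTerm k I) (compositions n k)) ≡ rhs k I
mainTheorem8 n .(length I) I (positive , sum≡n) refl = begin
  sum (map (lhsTerm k I) (compositions n k))  ≡⟨ sum-compositionWeight k (lhsFactor I) 0 n ⟩
  totalWeight k (lhsFactor I) 0 n             ≡⟨ cong (totalWeight k (lhsFactor I) 0) (trans (psum-length I) sum≡n) ⟨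
  totalWeight k (lhsFactor I) 0 (psum k I)    ≡⟨ totalWeight-endpoint k refl (transfer-composition positive) ⟩
  product (applyUpTo (rhsFactor I) k)         ≡⟨ ∏rhsFactor≡rhs I positive ⟩
  rhs k I                                     ∎
  where k = length I
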